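{- Let $\Gamma$ be a simplicial complex on $[n]$ whose Stanley–Reisner ideal $I_\Gamma\subset S_{[n]}$ is a USLI, $I_\Gamma=L(k_\bullet)$. (1) If $I_\Gamma\neq0$ and $k_d$ is the last nonzero entry of $k_\bullet$, then $\Gamma$ has exactly $d$ facets, namely $F_i=\{R_j:1\le j\le i-1\}\cup[R_i+1,n]$ for $1\le i\le d-1$, and $F_d=\{R_1,\ldots,R_{d-1}\}\cup[R_d,n]$, where $R_j=j+\sum_{i=1}^jk_i$ and $[a,b]=\{a,a+1,\ldots,b\}$. (2) If $\Gamma'$ is a shifted complex on $[n]$ with $f(\Gamma')=f(\Gamma)$, then $\Gamma'=\Gamma$.
   Context: $S_{[n]}=\mathbf k[x_1,\ldots,x_n]\subset S=\mathbf k[x_i:i\in\mathbb N]$. A simplicial complex on $[n]$ is a family of subsets closed under subsets; facets are maximal faces; $f(\Gamma)$ is the $f$-vector; shifted means $F\in\Gamma$, $i\in F$, $i<j\le n$ imply $(F\setminus\{i\})\cup\{j\}\in\Gamma$. $I_\Gamma=\langle\prod_{i\in F}x_i:F\subseteq[n],F\notin\Gamma\rangle$. Monomials are ordered by graded lex: lower degree is larger, and equal degrees are compared lexicographically with $x_1>x_2>\cdots$. A squarefree monomial ideal $I\subset S$ is a squarefree lexsegment ideal of $S$ if for each monomial $m\in I$ and each squarefree $m'\in S$ with $\deg m'=\deg m$ and $m'>_{\mathrm{lex}}m$, $m'\in I$. An ideal $L$ of $S$ or $S_{[n]}$ is a USLI if it is finitely generated in each degree and $LS$ is a squarefree lexsegment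 ideal of $S$. For a sequence $k_\bullet=(k_i)_{i\in\mathbb N}$ of nonnegative integers, $L(k_\bullet)$ denotes the USLI with $k_i$ minimal generators of degree $i$; its minimal generators are $\bigcup_{r\ge1}\{(\prod_{j=1}^{r-1}x_{R_j})x_l: R_{r-1}+1\le l\le R_r-1\}$ with $R_j=j+\sum_{i=1}^jk_i$ ($R_0=0$). -}

module Defs where

open import Data.Bool using (Bool; true; false; if_then_else_)
open import Data.Bool.Properties using () renaming (_≟_ to _≟ᵇ_)
open import Data.Nat using (ℕ; zero; suc; _+_; _≤_; _<_; _<ᵇ_)
open import Data.Nat.Properties using () renaming (_≟_ to _≟ℕ_)
open import Data.Fin using (Fin; toℕ)
open import Data.Fin.Subset using (Subset; _∈_; _∉_; _⊆_; _⊂_; ∣_∣; inside; outside)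
open import Data.Fin.Subset.Properties using (_⊂?_; anySubset?)
open import Data.List using (List; []; _∷_; _++_; map; filter; length)
open import Data.Vec using ([]; _∷_; _[_]≔_)
open import Data.Product using (Σ; ∃; _×_; _,_)
open import Relation.Nullary using (Dec; yes; no; ¬_)
open import Relation.Nullary.Decidable using (_×-dec_; _→-dec_; ¬?)
open import Relation.Binary.PropositionalEquality using (_≡_)
open import Function.Bundles using (_⇔_)

-- The ground set [n] = {1,…,n} is represented by Fin n: the index p : Fin n
-- stands for the element (toℕ p + 1), i.e. the variable x_{toℕ p + 1}.
-- A subset of [n] (= a squarefree monomial of S_[n]) is a Subset n.

Family : ℕ → Set
Family n = Subset n → Bool

IsSimplicialComplex : ∀ {n} → Family n → Set
IsSimplicialComplex {n} Γ = ∀ (F G : Subset n) → G ⊆ F → Γ F ≡ true → Γ G ≡ true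

IsShifted : ∀ {n} → Family n → Set
IsShifted {n} Γ = ∀ (F : Subset n) (i j : Fin n) → Γ F ≡ true → i ∈ F →
  toℕ i < toℕ j → Γ ((F [ i ]≔ outside) [ j ]≔ inside) ≡ true

subsets : ∀ n → List (Subset n)
subsets zero    = [] ∷ []
subsets (suc n) = map (inside ∷_) (subsets n) ++ map (outside ∷_) (subsets n)

-- f-vector: f Γ i = number of faces of Γ with i elements (dimension i - 1).
fvec : ∀ {n} → Family n → ℕ → ℕ
fvec {n} Γ i = length (filter (λ F → (Γ F ≟ᵇ true) ×-dec (∣ F ∣ ≟ℕ i)) (subsets n))

-- Stanley–Reisner ideal I_Γ = ⟨ x_F : F ⊆ [n], F ∉ Γ ⟩.
-- A monomial lies in a monomial ideal iff it is divisible by one of the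
-- generators; we only need squarefree monomials of S = k[x_1,x_2,…].
-- Every squarefree monomial of S lies in some S_[N]; it is represented by
-- a Subset N (index q : Fin N stands for x_{toℕ q + 1}).

InIΓS : ∀ {n N} → Family n → Subset N → Set
InIΓS {n} {N} Γ A = Σ (Subset n) λ F → Γ F ≡ false ×
  (∀ (p : Fin n) → p ∈ F → Σ (Fin N) λ q → toℕ q ≡ toℕ p × q ∈ A)

-- Lex order on squarefree monomials of S_[N] with x_1 > x_2 > ⋯ :
-- x_B >lex x_A iff at the first variable where they differ, B has it.
_>lex_ : ∀ {N} → Subset N → Subset N → Set
_>lex_ {N} B A = Σ (Fin N) λ q → q ∈ B × q ∉ A ×
  (∀ (r : Fin N) → toℕ r < toℕ q → (r ∈ B ⇔ r ∈ A))

-- I_Γ is a USLI: I_Γ is finitely generated (automatic) and I_Γ S is a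
-- squarefree lexsegment ideal of S: for squarefree monomials x_A ∈ I_Γ S and
-- squarefree x_B of the same degree with x_B >lex x_A, x_B ∈ I_Γ S.
-- (Any two squarefree monomials of S lie in a common S_[N].)
IsUSLI : ∀ {n} → Family n → Set
IsUSLI Γ = ∀ (N : ℕ) (A B : Subset N) → ∣ A ∣ ≡ ∣ B ∣ → B >lex A →
  InIΓS Γ A → InIΓS Γ B

IΓ≢0 : ∀ {n} → Family n → Set
IΓ≢0 {n} Γ = Σ (Subset n) λ F → Γ F ≡ false

-- Minimal generators of I_Γ are the x_F with F a minimal non-face.
IsMinNonface : ∀ {n} → Family n → Subset n → Set
IsMinNonface {n} Γ F = Γ F ≡ false × (∀ (G : Subset n) → G ⊂ F → Γ G ≡ true)

allSubset? : ∀ {n} {P : Subset n → Set} → (∀ G → Dec (P G)) → Dec (∀ G → P G)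
allSubset? {P = P} P? with anySubset? (λ G → ¬? (P? G))
... | yes (G , ¬PG) = no (λ all → ¬PG (all G))
... | no ¬ex = yes (λ G → helper G (P? G))
  where
  helper : ∀ G → Dec (P G) → P G
  helper G (yes p) = p
  helper G (no ¬p) = Data.Empty.⊥-elim (¬ex (G , ¬p))
    where import Data.Empty

isMinNonface? : ∀ {n} (Γ : Family n) (F : Subset n) → Dec (IsMinNonface Γ F)
isMinNonface? Γ F = (Γ F ≟ᵇ false) ×-dec allSubset? (λ G → (G ⊂? F) →-dec (Γ G ≟ᵇ true))

numMinGens : ∀ {n} → Family n → ℕ → ℕ
numMinGens {n} Γ i =
  length (filter (λ F → isMinNonface? Γ F ×-dec (∣ F ∣ ≟ℕ i)) (subsets n))

sumK : (ℕ → ℕ) → ℕ → ℕ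
sumK k zero    = 0
sumK k (suc j) = sumK k j + k (suc j)

R : (ℕ → ℕ) → ℕ → ℕ
R k j = j + sumK k j

IsFacet : ∀ {n} → Family n → Subset n → Set
IsFacet {n} Γ F = Γ F ≡ true × (∀ (G : Subset n) → F ⊆ G → Γ G ≡ true → G ≡ F)

InFset : (k : ℕ → ℕ) (n d i e : ℕ) → Set
InFset k n d i e =
  (Σ ℕ λ j → 1 ≤ j × j < i × e ≡ R k j)
  ⊎ ((if i <ᵇ d then suc (R k i) else R k d) ≤ e × e ≤ n)
  where open import Data.Sum using (_⊎_)

IsFset : (k : ℕ → ℕ) (n d i : ℕ) → Subset n → Set
IsFset k n d i F = ∀ (p : Fin n) → (p ∈ F ⇔ InFset k n d i (suc (toℕ p)))

-- Induction on n, splitting off the first vertex x₁ (index zero).  If {x₁} is a face, the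
-- lexsegment property forces every subset of {x₂,…,xₙ} to be a face, so Γ is that simplex
-- together with the cone x₁ * link; then k₁ = 0, the link is again a USLI complex whose
-- generators are counted by k_{i+1}, and F₁ = [2,n] while F_{i+1} = {1} ∪ (F_i of the link,
-- shifted).  If {x₁} is not a face, Γ is a complex on {x₂,…,xₙ} whose ideal has lost the
-- generator x₁, and the sets F_i just shift by one.  For (2), the recursion
-- f_{i+1}(Γ) = f_i(link) + f_{i+1}(deletion) together with shiftedness forces Γ′ into the
-- same case as Γ (comparing f₁, resp. fₙ), and induction applies to the deletion, resp. link.
module Submission where

open import Defs
open import Data.Bool using (Bool; true; false; if_then_else_)
open import Data.Bool.Properties using (not-¬; ¬-not) renaming (_≟_ to _≟ᵇ_)
open import Data.Empty using (⊥-elim)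
open import Data.Fin using (Fin; zero; suc; toℕ; _↑ˡ_)
open import Data.Fin.Properties using (toℕ-↑ˡ; toℕ<n)
open import Data.Fin.Subset using (Subset; _∈_; _⊆_; ∣_∣; inside; outside; ⊤; ⊥; ⁅_⁆)
open import Data.Fin.Subset.Properties
  using (s⊆s; s⊂s; ⊆⊤; ⊥⊆; ∉⊥; ∈⊤; drop-there; drop-∷-⊆; drop-∷-⊂; ⊆-antisym; _⊂?_; anySubset?;
         p⊂q⇒∣p∣<∣q∣; ∣p∣≡n⇒p≡⊤; ∣⊤∣≡n; ∣⊥∣≡0)
open import Data.List using (List; []; _∷_; _++_; map; filter; length)
open import Data.List.Properties using (filter-≐; filter-++; filter-none; filter-some; length-++)
open import Data.List.Membership.Propositional using (lose) renaming (_∈_ to _∈ₗ_)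
open import Data.List.Membership.Propositional.Properties using (∈-map⁺; ∈-++⁺ˡ; ∈-++⁺ʳ)
open import Data.List.Relation.Unary.Any using (here; any?; satisfied)
open import Data.List.Relation.Unary.All using (universal)
open import Data.List.Relation.Unary.All.Properties using (¬Any⇒All¬)
open import Data.List.Relation.Binary.Sublist.Propositional using (⊆-refl)
open import Data.List.Relation.Binary.Sublist.Propositional.Properties using (filter⁺; length-mono-≤)
import Data.Nat as ℕ
open import Data.Nat using (ℕ; zero; suc; _+_; _≤_; _<_; _<ᵇ_; z≤n; s≤s)
open import Data.Nat.Properties
  using (suc-injective; +-suc; +-identityʳ; +-cancelʳ-≡; m≤m+n; ≤-refl; ≤-reflexive; ≤-trans; ≤-pred;
         <-irrefl; <-≤-trans; <⇒≢; <⇒≱; +-mono-<-≤; module ≤-Reasoning)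
  renaming (_≟_ to _≟ℕ_)
open import Data.Product using (Σ; ∃; _×_; _,_; proj₁; proj₂)
open import Data.Sum using (inj₁; inj₂)
open import Data.Vec using ([]; _∷_; _[_]≔_; here; there)
import Data.Vec as V
open import Function using (_∘_; case_of_)
open import Function.Bundles using (_⇔_; mk⇔; Equivalence)
open Equivalence using (to; from)
open import Function.Construct.Composition using (_⇔-∘_)
open import Function.Construct.Symmetry using (⇔-sym)
open import Level using (0ℓ)
open import Relation.Nullary using (yes; no; ¬_; contradiction)
open import Relation.Nullary.Decidable using (_×-dec_)
open import Relation.Unary using (Pred; Decidable; _≐_) renaming (_⊆_ to _⇒_)
open import Relation.Binary.PropositionalEquality
  using (_≡_; _≢_; refl; sym; trans; cong; cong₂; subst; module ≡-Reasoning)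

count : ∀ {n} {P : Pred (Subset n) 0ℓ} → Decidable P → ℕ
count {n} P? = length (filter P? (subsets n))

∈-subsets : ∀ {n} (F : Subset n) → F ∈ₗ subsets n
∈-subsets []            = here refl
∈-subsets (inside ∷ F)  = ∈-++⁺ˡ (∈-map⁺ (inside ∷_) (∈-subsets F))
∈-subsets (outside ∷ F) = ∈-++⁺ʳ (map (inside ∷_) _) (∈-map⁺ (outside ∷_) (∈-subsets F))

length-filter-map : ∀ {A B : Set} {P : Pred B 0ℓ} (P? : Decidable P) (f : A → B) xs →
  length (filter P? (map f xs)) ≡ length (filter (P? ∘ f) xs)
length-filter-map P? f []       = refl
length-filter-map P? f (x ∷ xs) with P? (f x)
... | yes _ = cong suc (length-filter-map P? f xs)
... | no  _ = length-filter-map P? f xs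

module _ {n : ℕ} {P : Pred (Subset n) 0ℓ} (P? : Decidable P) where

  count-≐ : {Q : Pred (Subset n) 0ℓ} (Q? : Decidable Q) → P ≐ Q → count P? ≡ count Q?
  count-≐ Q? P≐Q = cong length (filter-≐ P? Q? P≐Q (subsets n))

  count-mono : {Q : Pred (Subset n) 0ℓ} (Q? : Decidable Q) → P ⇒ Q → count P? ≤ count Q?
  count-mono Q? P⇒Q = length-mono-≤ (filter⁺ P? Q? (λ { refl → P⇒Q }) (⊆-refl {x = subsets n}))

  count-none : (∀ F → ¬ P F) → count P? ≡ 0
  count-none ¬P = cong length (filter-none P? (universal ¬P (subsets n)))

  count-pos : ∀ {F} → P F → 0 < count P?
  count-pos {F} PF = filter-some P? (lose (∈-subsets F) PF)

  count-witness : count P? ≢ 0 → ∃ P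
  count-witness count≢0 with any? P? (subsets n)
  ... | yes ∃P = satisfied ∃P
  ... | no ¬∃P = contradiction (cong length (filter-none P? (¬Any⇒All¬ (subsets n) ¬∃P))) count≢0

count-suc : ∀ {n} {P : Pred (Subset (suc n)) 0ℓ} (P? : Decidable P) →
  count P? ≡ count (P? ∘ (inside ∷_)) + count (P? ∘ (outside ∷_))
count-suc {n} P? = begin
  length (filter P? (ins ++ outs))                     ≡⟨ cong length (filter-++ P? ins outs) ⟩
  length (filter P? ins ++ filter P? outs)             ≡⟨ length-++ (filter P? ins) ⟩
  length (filter P? ins) + length (filter P? outs)     ≡⟨ cong₂ _+_ (length-filter-map P? _ (subsets n))
                                                                    (length-filter-map P? _ (subsets n)) ⟩
  count (P? ∘ (inside ∷_)) + count (P? ∘ (outside ∷_)) ∎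
  where
  open ≡-Reasoning
  ins outs : List (Subset (suc n))
  ins  = map (inside ∷_) (subsets n)
  outs = map (outside ∷_) (subsets n)

count-empty : ∀ n → count {n} (λ F → ∣ F ∣ ≟ℕ 0) ≡ 1
count-empty zero    = refl
count-empty (suc n) = trans (count-suc {n} (λ F → ∣ F ∣ ≟ℕ 0))
  (cong₂ _+_ (count-none {n} (λ F → ∣ inside ∷ F ∣ ≟ℕ 0) (λ _ ())) (count-empty n))

∣p∣≡0⇒p≡⊥ : ∀ {n} {p : Subset n} → ∣ p ∣ ≡ 0 → p ≡ ⊥
∣p∣≡0⇒p≡⊥ {p = []}          _  = refl
∣p∣≡0⇒p≡⊥ {p = outside ∷ p} eq = cong (outside ∷_) (∣p∣≡0⇒p≡⊥ eq)

∣p∣≡1⇒p≡⁅x⁆ : ∀ {n} {p : Subset n} → ∣ p ∣ ≡ 1 → ∃ λ x → p ≡ ⁅ x ⁆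
∣p∣≡1⇒p≡⁅x⁆ {p = inside ∷ p}  eq = zero , cong (inside ∷_) (∣p∣≡0⇒p≡⊥ (suc-injective eq))
∣p∣≡1⇒p≡⁅x⁆ {p = outside ∷ p} eq with ∣p∣≡1⇒p≡⁅x⁆ {p = p} eq
... | x , p≡⁅x⁆ = suc x , cong (outside ∷_) p≡⁅x⁆

∣p∣≡suc⇒∃∈ : ∀ {n} {p : Subset n} {j} → ∣ p ∣ ≡ suc j → ∃ λ x → x ∈ p
∣p∣≡suc⇒∃∈ {p = inside ∷ p}  _  = zero , here
∣p∣≡suc⇒∃∈ {p = outside ∷ p} eq with ∣p∣≡suc⇒∃∈ eq
... | x , x∈p = suc x , there x∈p

⊥[x]≔inside≡⁅x⁆ : ∀ {n} (x : Fin n) → ⊥ [ x ]≔ inside ≡ ⁅ x ⁆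
⊥[x]≔inside≡⁅x⁆ zero    = refl
⊥[x]≔inside≡⁅x⁆ (suc x) = cong (outside ∷_) (⊥[x]≔inside≡⁅x⁆ x)

∣p∣≡n⇒∃p[x]≔inside≡⊤ : ∀ {n} {p : Subset (suc n)} → ∣ p ∣ ≡ n → ∃ λ x → p [ x ]≔ inside ≡ ⊤
∣p∣≡n⇒∃p[x]≔inside≡⊤ {p = outside ∷ p} eq = zero , cong (inside ∷_) (∣p∣≡n⇒p≡⊤ eq)
∣p∣≡n⇒∃p[x]≔inside≡⊤ {suc n} {inside ∷ p} eq with ∣p∣≡n⇒∃p[x]≔inside≡⊤ (suc-injective eq)
... | x , eq′ = suc x , cong (inside ∷_) eq′

-- Link and deletion of the first vertex

Full Void : ∀ {n} → Family n → Set
Full Γ = ∀ F → Γ F ≡ true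
Void Γ = ∀ F → Γ F ≡ false

link deletion : ∀ {n} → Family (suc n) → Family n
link     Γ F = Γ (inside ∷ F)
deletion Γ F = Γ (outside ∷ F)

module _ {n} {Γ : Family (suc n)} where

  link-simplicial : IsSimplicialComplex Γ → IsSimplicialComplex (link Γ)
  link-simplicial simp F G G⊆F = simp (inside ∷ F) (inside ∷ G) (s⊆s G⊆F)

  deletion-simplicial : IsSimplicialComplex Γ → IsSimplicialComplex (deletion Γ)
  deletion-simplicial simp F G G⊆F = simp (outside ∷ F) (outside ∷ G) (s⊆s G⊆F)

  link-shifted : IsShifted Γ → IsShifted (link Γ)
  link-shifted sh F i j F∈Γ i∈F i<j = sh (inside ∷ F) (suc i) (suc j) F∈Γ (there i∈F) (s≤s i<j)

  deletion-shifted : IsShifted Γ → IsShifted (deletion Γ)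
  deletion-shifted sh F i j F∈Γ i∈F i<j = sh (outside ∷ F) (suc i) (suc j) F∈Γ (there i∈F) (s≤s i<j)

  link-void : IsSimplicialComplex Γ → Γ ⁅ zero ⁆ ≡ false → Void (link Γ)
  link-void simp ⁅0⁆∉Γ F with Γ (inside ∷ F) in F∈Γ
  ... | false = refl
  ... | true  = contradiction ⁅0⁆∉Γ (not-¬ (simp (inside ∷ F) ⁅ zero ⁆ (s⊆s ⊥⊆) F∈Γ))

∣p++q∣≡∣p∣+∣q∣ : ∀ {m n} (p : Subset m) (q : Subset n) → ∣ p V.++ q ∣ ≡ ∣ p ∣ + ∣ q ∣
∣p++q∣≡∣p∣+∣q∣ []            q = refl
∣p++q∣≡∣p∣+∣q∣ (inside ∷ p)  q = cong suc (∣p++q∣≡∣p∣+∣q∣ p q)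
∣p++q∣≡∣p∣+∣q∣ (outside ∷ p) q = ∣p++q∣≡∣p∣+∣q∣ p q

x∈p⇒x↑ˡ∈p++q : ∀ {m n} {p : Subset m} {x : Fin m} (q : Subset n) → x ∈ p → (x ↑ˡ n) ∈ p V.++ q
x∈p⇒x↑ˡ∈p++q q here        = here
x∈p⇒x↑ˡ∈p++q q (there x∈p) = there (x∈p⇒x↑ˡ∈p++q q x∈p)

x∈⊥++q⇒m≤x : ∀ m {n} {q : Subset n} {x : Fin (m + n)} → x ∈ ⊥ {m} V.++ q → m ≤ toℕ x
x∈⊥++q⇒m≤x zero    _                 = z≤n
x∈⊥++q⇒m≤x (suc m) {x = suc x} (there x∈) = s≤s (x∈⊥++q⇒m≤x m x∈)

_divides_ : ∀ {n N} → Subset n → Subset N → Set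
_divides_ {n} {N} F A = ∀ (p : Fin n) → p ∈ F → ∃ λ (q : Fin N) → toℕ q ≡ toℕ p × q ∈ A

∷-divides-∷ : ∀ {n N} s {F : Subset n} {A : Subset N} → F divides A → (s ∷ F) divides (s ∷ A)
∷-divides-∷ s F∣A zero    here          = zero , refl , here
∷-divides-∷ s F∣A (suc p) (there p∈F) with F∣A p p∈F
... | q , q≡p , q∈A = suc q , cong suc q≡p , there q∈A

divides-drop-∷ : ∀ {n N} {x s} {F : Subset n} {A : Subset N} → (x ∷ F) divides (s ∷ A) → F divides A
divides-drop-∷ xF∣sA p p∈F with xF∣sA (suc p) (there p∈F)
... | suc q , q≡p , there q∈A = q , suc-injective q≡p , q∈A

∷->lex-∷ : ∀ {N} s {A B : Subset N} → B >lex A → (s ∷ B) >lex (s ∷ A)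
∷->lex-∷ s (q , q∈B , q∉A , agree) = suc q , there q∈B , q∉A ∘ drop-there , agree′
  where
  agree′ : ∀ r → toℕ r < suc (toℕ q) → (r ∈ (s ∷ _) ⇔ r ∈ (s ∷ _))
  agree′ zero    _         = mk⇔ (λ { here → here }) (λ { here → here })
  agree′ (suc r) (s≤s r<q) = mk⇔ (there ∘ to (agree r r<q) ∘ drop-there) (there ∘ from (agree r r<q) ∘ drop-there)

module _ {n} {Γ : Family (suc n)} (usli : IsUSLI Γ) where

  deletion-USLI : IsUSLI (deletion Γ)
  deletion-USLI N A B ∣A∣≡∣B∣ B>A (F , F∉Γ , F∣A)
    with usli (suc N) (outside ∷ A) (outside ∷ B) ∣A∣≡∣B∣ (∷->lex-∷ outside B>A)
              (outside ∷ F , F∉Γ , ∷-divides-∷ outside F∣A)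
  ... | outside ∷ F′ , F′∉Γ , F′∣B = F′ , F′∉Γ , divides-drop-∷ F′∣B
  ... | inside ∷ F′ , _ , F′∣B with F′∣B zero here
  ...   | zero , _ , ()

  link-USLI : Full (deletion Γ) → IsUSLI (link Γ)
  link-USLI full N A B ∣A∣≡∣B∣ B>A (F , F∉Γ , F∣A)
    with usli (suc N) (inside ∷ A) (inside ∷ B) (cong suc ∣A∣≡∣B∣) (∷->lex-∷ inside B>A)
              (inside ∷ F , F∉Γ , ∷-divides-∷ inside F∣A)
  ... | inside ∷ F′ , F′∉Γ , F′∣B = F′ , F′∉Γ , divides-drop-∷ F′∣B
  ... | outside ∷ F′ , F′∉Γ , _ = contradiction F′∉Γ (not-¬ (full F′))

  -- For a nonface G ∌ x₁ of size s + 1, x_B = x₁ · (s variables beyond x_{n+1}) has the degree of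
  -- x_A = x_G and is lex-larger, so x_B ∈ I_Γ S; but the only nonface that could divide it is ⊆ {x₁}.
  deletion-full : IsSimplicialComplex Γ → Γ ⁅ zero ⁆ ≡ true → Full (deletion Γ)
  deletion-full simp ⁅0⁆∈Γ G with Γ (outside ∷ G) in G∈Γ | ∣ G ∣ in ∣G∣
  ... | true  | _     = refl
  ... | false | zero  = contradiction (subst (λ H → Γ (outside ∷ H) ≡ false) (∣p∣≡0⇒p≡⊥ ∣G∣) G∈Γ)
                                      (not-¬ (simp ⁅ zero ⁆ ⊥ ⊥⊆ ⁅0⁆∈Γ))
  ... | false | suc s = ⊥-elim (B∉IΓS (usli _ A B ∣A∣≡∣B∣ B>A (outside ∷ G , G∈Γ , G∣A)))
    where
    A B : Subset (suc (n + s))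
    A = outside ∷ (G V.++ ⊥ {s})
    B = inside ∷ (⊥ {n} V.++ ⊤ {s})
    ∣A∣≡∣B∣ : ∣ A ∣ ≡ ∣ B ∣
    ∣A∣≡∣B∣ = begin
      ∣ G V.++ ⊥ {s} ∣            ≡⟨ ∣p++q∣≡∣p∣+∣q∣ G ⊥ ⟩
      ∣ G ∣ + ∣ ⊥ {s} ∣           ≡⟨ cong₂ _+_ ∣G∣ (∣⊥∣≡0 s) ⟩
      suc s + 0                   ≡⟨ cong ℕ.suc (+-identityʳ s) ⟩
      suc s                       ≡⟨ cong ℕ.suc (sym (∣⊤∣≡n s)) ⟩
      suc (0 + ∣ ⊤ {s} ∣)         ≡⟨ cong (ℕ.suc ∘ (_+ ∣ ⊤ {s} ∣)) (sym (∣⊥∣≡0 n)) ⟩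
      suc (∣ ⊥ {n} ∣ + ∣ ⊤ {s} ∣) ≡⟨ cong ℕ.suc (sym (∣p++q∣≡∣p∣+∣q∣ (⊥ {n}) (⊤ {s}))) ⟩
      ∣ B ∣                       ∎
      where open ≡-Reasoning
    B>A : B >lex A
    B>A = zero , here , (λ ()) , λ _ ()
    G∣A : (outside ∷ G) divides A
    G∣A = ∷-divides-∷ outside (λ p p∈G → p ↑ˡ s , toℕ-↑ˡ p s , x∈p⇒x↑ˡ∈p++q ⊥ p∈G)
    B∉IΓS : ¬ InIΓS Γ B
    B∉IΓS (F , F∉Γ , F∣B) = not-¬ (simp ⁅ zero ⁆ F F⊆⁅0⁆ ⁅0⁆∈Γ) F∉Γ
      where
      F⊆⁅0⁆ : F ⊆ ⁅ zero ⁆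
      F⊆⁅0⁆ {zero}  _   = here
      F⊆⁅0⁆ {suc p} p∈F with F∣B (suc p) p∈F
      ... | suc q , q≡p , there q∈⊥++⊤ =
        contradiction (≤-trans (x∈⊥++q⇒m≤x n q∈⊥++⊤) (≤-reflexive (suc-injective q≡p))) (<⇒≱ (toℕ<n p))

-- f-vectors and shifted complexes

isFace? : ∀ {n} (Γ : Family n) (i : ℕ) → Decidable (λ F → Γ F ≡ true × ∣ F ∣ ≡ i)
isFace? Γ i F = (Γ F ≟ᵇ true) ×-dec (∣ F ∣ ≟ℕ i)

module _ {n} (Γ : Family (suc n)) where

  fvec-zero : fvec Γ 0 ≡ fvec (deletion Γ) 0
  fvec-zero = trans (count-suc (isFace? Γ 0))
    (cong (_+ fvec (deletion Γ) 0) (count-none (isFace? Γ 0 ∘ (inside ∷_)) λ _ ()))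

  fvec-suc : ∀ i → fvec Γ (suc i) ≡ fvec (link Γ) i + fvec (deletion Γ) (suc i)
  fvec-suc i = trans (count-suc (isFace? Γ (suc i)))
    (cong (_+ fvec (deletion Γ) (suc i))
      (count-≐ _ (isFace? (link Γ) i)
        ((λ (F∈Γ , ∣F∣) → F∈Γ , suc-injective ∣F∣) , λ (F∈Γ , ∣F∣) → F∈Γ , cong ℕ.suc ∣F∣)))

module _ {n} (Γ : Family n) where

  fvec-cong : ∀ {Δ} → (∀ F → Γ F ≡ Δ F) → ∀ i → fvec Γ i ≡ fvec Δ i
  fvec-cong {Δ} Γ≗Δ i = count-≐ _ (isFace? Δ i)
    ( (λ (F∈Γ , ∣F∣) → trans (sym (Γ≗Δ _)) F∈Γ , ∣F∣)
    , (λ (F∈Δ , ∣F∣) → trans (Γ≗Δ _) F∈Δ , ∣F∣))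

  fvec-mono : ∀ {Δ} i → (∀ F → ∣ F ∣ ≡ i → Γ F ≡ true → Δ F ≡ true) → fvec Γ i ≤ fvec Δ i
  fvec-mono {Δ} i Γ⊆Δ = count-mono _ (isFace? Δ i) λ (F∈Γ , ∣F∣) → Γ⊆Δ _ ∣F∣ F∈Γ , ∣F∣

  fvec-void : Void Γ → ∀ i → fvec Γ i ≡ 0
  fvec-void void i = count-none (isFace? Γ i) λ F (F∈Γ , _) → not-¬ F∈Γ (void F)

  fvec-pos : ∀ {F} → Γ F ≡ true → 0 < fvec Γ ∣ F ∣
  fvec-pos F∈Γ = count-pos (isFace? Γ _) (F∈Γ , refl)

  fvec-witness : ∀ {i} → fvec Γ i ≢ 0 → ∃ λ F → Γ F ≡ true × ∣ F ∣ ≡ i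
  fvec-witness = count-witness _

fvec-size-zero : ∀ {n} (Γ : Family n) → fvec Γ 0 ≡ (if Γ ⊥ then 1 else 0)
fvec-size-zero {zero} Γ with Γ []
... | true  = refl
... | false = refl
fvec-size-zero {suc n} Γ = trans (fvec-zero Γ) (fvec-size-zero (deletion Γ))

fvec-link-void : ∀ {n} (Γ : Family (suc n)) → Void (link Γ) → ∀ i → fvec Γ i ≡ fvec (deletion Γ) i
fvec-link-void Γ void zero    = fvec-zero Γ
fvec-link-void Γ void (suc i) = trans (fvec-suc Γ i) (cong (_+ fvec (deletion Γ) (suc i)) (fvec-void (link Γ) void i))

if-1-0-injective : ∀ {a b : Bool} → (if a then 1 else 0) ≡ (if b then 1 else 0) → a ≡ b
if-1-0-injective {true}  {true}  _ = refl
if-1-0-injective {false} {false} _ = refl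

shifted-singletons : ∀ {n} {Γ : Family (suc n)} → IsShifted Γ →
  Γ ⁅ zero ⁆ ≡ true → ∀ x → deletion Γ ⁅ x ⁆ ≡ true
shifted-singletons {Γ = Γ} shifted ⁅0⁆∈Γ x = subst (λ H → Γ (outside ∷ H) ≡ true) (⊥[x]≔inside≡⁅x⁆ x)
  (shifted ⁅ zero ⁆ zero (suc x) ⁅0⁆∈Γ here (s≤s z≤n))

shifted-top : ∀ {n} {Γ : Family (suc n)} → IsShifted Γ →
  ∀ {F} → Γ F ≡ true → ∣ F ∣ ≡ n → deletion Γ ⊤ ≡ true
shifted-top {Γ = Γ} _ {outside ∷ H} H∈Γ ∣H∣ = subst (λ H → Γ (outside ∷ H) ≡ true) (∣p∣≡n⇒p≡⊤ ∣H∣) H∈Γ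
shifted-top {suc n} {Γ} shifted {inside ∷ H} H∈Γ ∣H∣ with ∣p∣≡n⇒∃p[x]≔inside≡⊤ (suc-injective ∣H∣)
... | x , H[x]≡⊤ = subst (λ H → Γ (outside ∷ H) ≡ true) H[x]≡⊤
  (shifted (inside ∷ H) zero (suc x) H∈Γ here (s≤s z≤n))

-- Shifting {x₁} would make every singleton a face, giving Γ′ one more vertex than Γ.
shifted-⁅0⁆∉ : ∀ {n} {Γ Γ′ : Family (suc n)} → IsShifted Γ′ → Void (link Γ) →
  fvec Γ′ 1 ≡ fvec Γ 1 → Γ′ ⁅ zero ⁆ ≡ false
shifted-⁅0⁆∉ {n} {Γ} {Γ′} shifted void f₁ with Γ′ ⁅ zero ⁆ in ⁅0⁆∈Γ′
... | false = refl
... | true  = contradiction fΓ₁<fΓ₁ (<-irrefl refl)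
  where
  deletion-⊆ : ∀ F → ∣ F ∣ ≡ 1 → deletion Γ F ≡ true → deletion Γ′ F ≡ true
  deletion-⊆ F ∣F∣ _ with ∣p∣≡1⇒p≡⁅x⁆ {p = F} ∣F∣
  ... | x , refl = shifted-singletons shifted ⁅0⁆∈Γ′ x
  ⁅0⁆-counted : 0 < fvec (link Γ′) 0
  ⁅0⁆-counted = subst (λ i → 0 < fvec (link Γ′) i) (∣⊥∣≡0 n) (fvec-pos (link Γ′) ⁅0⁆∈Γ′)
  fΓ₁<fΓ₁ : fvec (deletion Γ) 1 < fvec (deletion Γ) 1
  fΓ₁<fΓ₁ = begin-strict
    fvec (deletion Γ) 1                     <⟨ +-mono-<-≤ ⁅0⁆-counted (fvec-mono (deletion Γ) 1 deletion-⊆) ⟩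
    fvec (link Γ′) 0 + fvec (deletion Γ′) 1 ≡⟨ sym (fvec-suc Γ′ 0) ⟩
    fvec Γ′ 1                               ≡⟨ f₁ ⟩
    fvec Γ 1                                ≡⟨ fvec-link-void Γ void 1 ⟩
    fvec (deletion Γ) 1                     ∎
    where open ≤-Reasoning

-- Γ has a face of size n, hence so does Γ′, and shifting it yields {x₂,…,x_{n+1}}.
shifted-deletion-full : ∀ {n} {Γ Γ′ : Family (suc n)} → IsSimplicialComplex Γ′ → IsShifted Γ′ →
  Full (deletion Γ) → fvec Γ′ n ≡ fvec Γ n → Full (deletion Γ′)
shifted-deletion-full {n} {Γ} {Γ′} simp′ shifted full fₙ G =
  simp′ (outside ∷ ⊤) (outside ∷ G) (s⊆s ⊆⊤) ⊤∈deletion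
  where
  fΓ′ₙ≢0 : fvec Γ′ n ≢ 0
  fΓ′ₙ≢0 fΓ′ₙ≡0 =
    <⇒≢ (subst (λ i → 0 < fvec Γ i) (∣⊤∣≡n n) (fvec-pos Γ (full ⊤))) (trans (sym fΓ′ₙ≡0) fₙ)
  ⊤∈deletion : deletion Γ′ ⊤ ≡ true
  ⊤∈deletion = let F , F∈Γ′ , ∣F∣ = fvec-witness Γ′ fΓ′ₙ≢0 in shifted-top shifted F∈Γ′ ∣F∣

shifted-unique : ∀ {n} {Γ Γ′ : Family n} → IsSimplicialComplex Γ → IsUSLI Γ →
  IsSimplicialComplex Γ′ → IsShifted Γ′ → (∀ i → fvec Γ′ i ≡ fvec Γ i) → ∀ F → Γ′ F ≡ Γ F
shifted-unique {zero} {Γ} {Γ′} _ _ _ _ f [] =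
  if-1-0-injective (trans (sym (fvec-size-zero Γ′)) (trans (f 0) (fvec-size-zero Γ)))
shifted-unique {suc n} {Γ} {Γ′} simp usli simp′ shifted f F with Γ ⁅ zero ⁆ in ⁅0⁆∈Γ
... | false = ghost F
  where
  void  = link-void simp ⁅0⁆∈Γ
  void′ = link-void simp′ (shifted-⁅0⁆∉ shifted void (f 1))
  ghost : ∀ F → Γ′ F ≡ Γ F
  ghost (inside ∷ G)  = trans (void′ G) (sym (void G))
  ghost (outside ∷ G) = shifted-unique (deletion-simplicial simp) (deletion-USLI usli)
    (deletion-simplicial simp′) (deletion-shifted shifted)
    (λ i → trans (sym (fvec-link-void Γ′ void′ i)) (trans (f i) (fvec-link-void Γ void i))) G
... | true = cone F
  where
  full  = deletion-full usli simp ⁅0⁆∈Γ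
  full′ = shifted-deletion-full simp′ shifted full (f n)
  full≗full′ : ∀ G → deletion Γ G ≡ deletion Γ′ G
  full≗full′ G = trans (full G) (sym (full′ G))
  flink : ∀ i → fvec (link Γ′) i ≡ fvec (link Γ) i
  flink i = +-cancelʳ-≡ _ _ _ (begin
    fvec (link Γ′) i + fvec (deletion Γ′) (suc i) ≡⟨ sym (fvec-suc Γ′ i) ⟩
    fvec Γ′ (suc i)                               ≡⟨ f (suc i) ⟩
    fvec Γ (suc i)                                ≡⟨ fvec-suc Γ i ⟩
    fvec (link Γ) i + fvec (deletion Γ) (suc i)   ≡⟨ cong (fvec (link Γ) i +_)
                                                         (fvec-cong (deletion Γ) full≗full′ (suc i)) ⟩
    fvec (link Γ) i + fvec (deletion Γ′) (suc i)  ∎)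
    where open ≡-Reasoning
  cone : ∀ F → Γ′ F ≡ Γ F
  cone (outside ∷ G) = sym (full≗full′ G)
  cone (inside ∷ G)  = shifted-unique (link-simplicial simp) (link-USLI usli full)
    (link-simplicial simp′) (link-shifted shifted) flink G

-- Minimal nonfaces and facets

isMinGen? : ∀ {n} (Γ : Family n) (i : ℕ) → Decidable (λ F → IsMinNonface Γ F × ∣ F ∣ ≡ i)
isMinGen? Γ i F = isMinNonface? Γ F ×-dec (∣ F ∣ ≟ℕ i)

module _ {n} {Γ : Family (suc n)} where

  minNonface-outside : ∀ {F} → IsMinNonface Γ (outside ∷ F) ⇔ IsMinNonface (deletion Γ) F
  minNonface-outside = mk⇔ (λ (F∉Γ , min) → F∉Γ , λ G G⊂F → min (outside ∷ G) (s⊂s G⊂F))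
                           (λ (F∉Γ , min) → F∉Γ , λ { (outside ∷ G) G⊂F → min G (drop-∷-⊂ G⊂F)
                                                     ; (inside ∷ G) (G⊆F , _) → case G⊆F here of λ () })

  minNonface-inside⇒ : ∀ {F} → IsMinNonface Γ (inside ∷ F) → IsMinNonface (link Γ) F
  minNonface-inside⇒ (F∉Γ , min) = F∉Γ , λ G G⊂F → min (inside ∷ G) (s⊂s G⊂F)

  minNonface-inside⇐ : Full (deletion Γ) → ∀ {F} → IsMinNonface (link Γ) F → IsMinNonface Γ (inside ∷ F)
  minNonface-inside⇐ full (F∉Γ , min) = F∉Γ , λ { (outside ∷ G) _ → full G
                                                ; (inside ∷ G) G⊂F → min G (drop-∷-⊂ G⊂F) }

  minNonface-inside-void : IsSimplicialComplex Γ → Γ ⊥ ≡ true → Void (link Γ) →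
    ∀ {F} → IsMinNonface Γ (inside ∷ F) ⇔ ∣ F ∣ ≡ 0
  minNonface-inside-void simp ⊥∈Γ void {F} = mk⇔ to′ from′
    where
    to′ : IsMinNonface Γ (inside ∷ F) → ∣ F ∣ ≡ 0
    to′ (_ , min) with ∣ F ∣ in ∣F∣
    ... | zero  = refl
    ... | suc _ with ∣p∣≡suc⇒∃∈ {p = F} ∣F∣
    ...   | x , x∈F =
      contradiction (void ⊥) (not-¬ (min ⁅ zero ⁆ (s⊆s ⊥⊆ , suc x , there x∈F , ∉⊥ ∘ drop-there)))
    from′ : ∣ F ∣ ≡ 0 → IsMinNonface Γ (inside ∷ F)
    from′ ∣F∣ rewrite ∣p∣≡0⇒p≡⊥ {p = F} ∣F∣ = void ⊥ , λ
      { (outside ∷ G) (G⊆⁅0⁆ , _) → simp ⊥ (outside ∷ G) (s⊆s (drop-∷-⊆ G⊆⁅0⁆)) ⊥∈Γ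
      ; (inside ∷ G) (G⊆⁅0⁆ , zero , _ , 0∉G) → contradiction here 0∉G
      ; (inside ∷ G) (G⊆⁅0⁆ , suc x , there x∈⊥ , _) → contradiction x∈⊥ ∉⊥ }

  numMinGens-full-deletion : Full (deletion Γ) → ∀ i → numMinGens Γ (suc i) ≡ numMinGens (link Γ) i
  numMinGens-full-deletion full i = begin
    numMinGens Γ (suc i)                                             ≡⟨ count-suc (isMinGen? Γ (suc i)) ⟩
    count (isMinGen? Γ (suc i) ∘ (inside ∷_)) + count (isMinGen? Γ (suc i) ∘ (outside ∷_))
      ≡⟨ cong₂ _+_ (count-≐ _ (isMinGen? (link Γ) i)
                     ( (λ (min , ∣F∣) → minNonface-inside⇒ min , suc-injective ∣F∣)
                     , (λ (min , ∣F∣) → minNonface-inside⇐ full min , cong ℕ.suc ∣F∣)))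
                   (count-none (isMinGen? Γ (suc i) ∘ (outside ∷_)) λ F ((F∉Γ , _) , _) → not-¬ (full F) F∉Γ) ⟩
    numMinGens (link Γ) i + 0                                        ≡⟨ +-identityʳ _ ⟩
    numMinGens (link Γ) i                                            ∎
    where open ≡-Reasoning

  module _ (simp : IsSimplicialComplex Γ) (⊥∈Γ : Γ ⊥ ≡ true) (void : Void (link Γ)) where

    isEmptyAt? : ∀ i → Decidable (λ (F : Subset n) → ∣ F ∣ ≡ 0 × 1 ≡ i)
    isEmptyAt? i F = (∣ F ∣ ≟ℕ 0) ×-dec (1 ≟ℕ i)

    numMinGens-void-link : ∀ i → numMinGens Γ i ≡ count (isEmptyAt? i) + numMinGens (deletion Γ) i
    numMinGens-void-link i = trans (count-suc (isMinGen? Γ i)) (cong₂ _+_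
      (count-≐ (isMinGen? Γ i ∘ (inside ∷_)) (isEmptyAt? i)
        ( (λ (min , ∣F∣) → let ∣F∣≡0 = to min⇔empty min in ∣F∣≡0 , trans (cong ℕ.suc (sym ∣F∣≡0)) ∣F∣)
        , (λ (∣F∣ , 1≡i) → from min⇔empty ∣F∣ , trans (cong ℕ.suc ∣F∣) 1≡i)))
      (count-≐ (isMinGen? Γ i ∘ (outside ∷_)) (isMinGen? (deletion Γ) i)
        ( (λ (min , ∣F∣) → to minNonface-outside min , ∣F∣)
        , (λ (min , ∣F∣) → from minNonface-outside min , ∣F∣))))
      where
      min⇔empty : ∀ {F} → IsMinNonface Γ (inside ∷ F) ⇔ ∣ F ∣ ≡ 0
      min⇔empty = minNonface-inside-void simp ⊥∈Γ void

    numMinGens-void-link-one : numMinGens Γ 1 ≡ suc (numMinGens (deletion Γ) 1)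
    numMinGens-void-link-one = trans (numMinGens-void-link 1)
      (cong (_+ numMinGens (deletion Γ) 1)
        (trans (count-≐ (isEmptyAt? 1) (λ F → ∣ F ∣ ≟ℕ 0) (proj₁ , (_, refl))) (count-empty n)))

    numMinGens-void-link-suc-suc : ∀ j → numMinGens Γ (suc (suc j)) ≡ numMinGens (deletion Γ) (suc (suc j))
    numMinGens-void-link-suc-suc j = trans (numMinGens-void-link (suc (suc j)))
      (cong (_+ numMinGens (deletion Γ) (suc (suc j))) (count-none (isEmptyAt? (suc (suc j))) λ { _ (_ , ()) }))

module _ {n} (Γ : Family n) where

  numMinGens-zero : Γ ⊥ ≡ true → numMinGens Γ 0 ≡ 0
  numMinGens-zero ⊥∈Γ = count-none (isMinGen? Γ 0) λ F ((F∉Γ , _) , ∣F∣) →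
    not-¬ ⊥∈Γ (subst (λ G → Γ G ≡ false) (∣p∣≡0⇒p≡⊥ ∣F∣) F∉Γ)

  numMinGens-void : Γ ⊥ ≡ false → ∀ j → numMinGens Γ (suc j) ≡ 0
  numMinGens-void ⊥∉Γ j = count-none (isMinGen? Γ (suc j)) λ F ((_ , min) , ∣F∣) →
    let x , x∈F = ∣p∣≡suc⇒∃∈ {p = F} ∣F∣ in not-¬ (min ⊥ (⊥⊆ , x , x∈F , ∉⊥)) ⊥∉Γ

  numMinGens-witness : ∀ {i} → numMinGens Γ i ≢ 0 → IΓ≢0 Γ
  numMinGens-witness count≢0 = let F , (F∉Γ , _) , _ = count-witness (isMinGen? Γ _) count≢0 in F , F∉Γ

  nonface⇒∃minNonface : ∀ m {F} → ∣ F ∣ ≤ m → Γ F ≡ false → ∃ (IsMinNonface Γ)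
  nonface⇒∃minNonface m {F} ∣F∣≤m F∉Γ with anySubset? (λ G → (G ⊂? F) ×-dec (Γ G ≟ᵇ false))
  nonface⇒∃minNonface (suc m) ∣F∣≤m F∉Γ | yes (G , G⊂F , G∉Γ) =
    nonface⇒∃minNonface m (≤-pred (<-≤-trans (p⊂q⇒∣p∣<∣q∣ G⊂F) ∣F∣≤m)) G∉Γ
  nonface⇒∃minNonface zero ∣F∣≤m F∉Γ | yes (G , G⊂F , _) =
    contradiction (<-≤-trans (p⊂q⇒∣p∣<∣q∣ G⊂F) ∣F∣≤m) λ ()
  nonface⇒∃minNonface m {F} ∣F∣≤m F∉Γ | no ¬∃ = F , F∉Γ , λ G G⊂F → ¬-not (¬∃ ∘ (G ,_) ∘ (G⊂F ,_))

  numMinGens≡0⇒full : (∀ i → numMinGens Γ i ≡ 0) → Full Γ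
  numMinGens≡0⇒full none F with Γ F in F∈Γ
  ... | true  = refl
  ... | false = let M , min = nonface⇒∃minNonface _ ≤-refl F∈Γ in
    contradiction (none ∣ M ∣) (<⇒≢ (count-pos (isMinGen? Γ ∣ M ∣) (min , refl)) ∘ sym)

module _ {n} {Γ : Family (suc n)} where

  facet-inside : ∀ {F} → IsFacet Γ (inside ∷ F) ⇔ IsFacet (link Γ) F
  facet-inside = mk⇔
    (λ (F∈Γ , max) → F∈Γ , λ G F⊆G G∈Γ → cong V.tail (max (inside ∷ G) (s⊆s F⊆G) G∈Γ))
    (λ (F∈Γ , max) → F∈Γ , λ { (inside ∷ G) F⊆G G∈Γ → cong (inside ∷_) (max G (drop-∷-⊆ F⊆G) G∈Γ)
                             ; (outside ∷ G) F⊆G _ → case F⊆G here of λ () })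

  facet-outside⇒ : ∀ {F} → IsFacet Γ (outside ∷ F) → IsFacet (deletion Γ) F
  facet-outside⇒ (F∈Γ , max) = F∈Γ , λ G F⊆G G∈Γ → cong V.tail (max (outside ∷ G) (s⊆s F⊆G) G∈Γ)

  facet-outside-void⇐ : Void (link Γ) → ∀ {F} → IsFacet (deletion Γ) F → IsFacet Γ (outside ∷ F)
  facet-outside-void⇐ void (F∈Γ , max) = F∈Γ , λ
    { (outside ∷ G) F⊆G G∈Γ → cong (outside ∷_) (max G (drop-∷-⊆ F⊆G) G∈Γ)
    ; (inside ∷ G) _ G∈Γ → ⊥-elim (not-¬ G∈Γ (void G)) }

  facet-outside-full⇒ : Full (deletion Γ) → ∀ {F} → IsFacet Γ (outside ∷ F) → F ≡ ⊤
  facet-outside-full⇒ full (_ , max) = sym (cong V.tail (max (outside ∷ ⊤) (s⊆s ⊆⊤) (full ⊤)))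

  facet-outside-full⇐ : Full (deletion Γ) → link Γ ⊤ ≡ false → IsFacet Γ (outside ∷ ⊤)
  facet-outside-full⇐ full ⊤∉link = full ⊤ , λ
    { (outside ∷ G) ⊤⊆G _ → cong (outside ∷_) (⊆-antisym ⊆⊤ (drop-∷-⊆ ⊤⊆G))
    ; (inside ∷ G) ⊤⊆G G∈Γ →
        ⊥-elim (not-¬ (subst (λ H → Γ (inside ∷ H) ≡ true) (⊆-antisym ⊆⊤ (drop-∷-⊆ ⊤⊆G)) G∈Γ) ⊤∉link) }

-- The sets F_i

intervalStart : (k : ℕ → ℕ) (d i : ℕ) → ℕ
intervalStart k d i = if i <ᵇ d then suc (R k i) else R k d

j≤R : ∀ k j → j ≤ R k j
j≤R k j = m≤m+n j (sumK k j)

1≤intervalStart : ∀ k d i → 1 ≤ intervalStart k (suc d) i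
1≤intervalStart k d i with i <ᵇ suc d
... | true  = s≤s z≤n
... | false = ≤-trans (s≤s z≤n) (j≤R k (suc d))

IsFset-∷ : ∀ {k n d i x} {F : Subset n} →
  IsFset k (suc n) d i (x ∷ F) ⇔
    ((x ≡ inside ⇔ InFset k (suc n) d i 1) × (∀ p → p ∈ F ⇔ InFset k (suc n) d i (suc (suc (toℕ p)))))
IsFset-∷ = mk⇔
  (λ Fset → mk⇔ (λ { refl → to (Fset zero) here }) (λ e → head∈ (from (Fset zero) e))
          , λ p → mk⇔ (to (Fset (suc p)) ∘ there) (drop-there ∘ from (Fset (suc p))))
  (λ (head , tail) → λ { zero → mk⇔ (to head ∘ head∈) (λ e → subst (λ x → zero ∈ (x ∷ _)) (sym (from head e)) here)
                       ; (suc p) → mk⇔ (to (tail p) ∘ drop-there) (there ∘ from (tail p)) })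
  where
  head∈ : ∀ {n x} {F : Subset n} → zero ∈ (x ∷ F) → x ≡ inside
  head∈ here = refl

IsFset⇔⊤ : ∀ {k n d i} → (∀ (p : Fin n) → InFset k n d i (suc (toℕ p))) → ∀ {F} → IsFset k n d i F ⇔ F ≡ ⊤
IsFset⇔⊤ all = mk⇔ (λ Fset → ⊆-antisym ⊆⊤ λ {p} _ → from (Fset p) (all p))
                   (λ { refl p → mk⇔ (λ _ → all p) (λ _ → ∈⊤) })

IsFset-zero⇔⊤ : ∀ {k n d} {F : Subset n} → IsFset k n (suc d) 0 F ⇔ F ≡ ⊤
IsFset-zero⇔⊤ {k} {n} {d} = IsFset⇔⊤ {k} {n} {suc d} {0} λ p → inj₂ (s≤s z≤n , toℕ<n p)

IsFset-simplex⇔⊤ : ∀ {k n} → k 1 ≡ 0 → ∀ {F : Subset n} → IsFset k n 1 1 F ⇔ F ≡ ⊤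
IsFset-simplex⇔⊤ {k} {n} k₁≡0 = IsFset⇔⊤ {k} {n} {1} {1} λ p →
  inj₂ (subst (_≤ suc (toℕ p)) (cong ℕ.suc (sym k₁≡0)) (s≤s z≤n) , toℕ<n p)

sumK-ghost : ∀ {k k′} → k 1 ≡ suc (k′ 1) → (∀ j → k (suc (suc j)) ≡ k′ (suc (suc j))) →
  ∀ j → sumK k (suc j) ≡ suc (sumK k′ (suc j))
sumK-ghost k₁ k₂₊ zero    = k₁
sumK-ghost k₁ k₂₊ (suc j) = cong₂ _+_ (sumK-ghost k₁ k₂₊ j) (k₂₊ j)

R-shift-ghost : ∀ {k k′} → k 1 ≡ suc (k′ 1) → (∀ j → k (suc (suc j)) ≡ k′ (suc (suc j))) →
  ∀ j → R k (suc j) ≡ suc (R k′ (suc j))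
R-shift-ghost k₁ k₂₊ j = trans (cong (suc j +_) (sumK-ghost k₁ k₂₊ j)) (+-suc (suc j) _)

sumK-cone : ∀ {k} → k 1 ≡ 0 → ∀ j → sumK k (suc j) ≡ sumK (k ∘ suc) j
sumK-cone k₁ zero    = k₁
sumK-cone {k} k₁ (suc j) = cong (_+ k (suc (suc j))) (sumK-cone k₁ j)

R-shift-cone : ∀ {k} → k 1 ≡ 0 → ∀ j → R k (suc j) ≡ suc (R (k ∘ suc) j)
R-shift-cone k₁ j = cong (suc j +_) (sumK-cone k₁ j)

-- {x₁} ∉ Γ: k′ is k with k₁ lowered by one.
module Ghost (k k′ : ℕ → ℕ) (R-shift : ∀ j → R k (suc j) ≡ suc (R k′ (suc j))) where

  intervalStart-ghost : ∀ d i → intervalStart k (suc d) (suc i) ≡ suc (intervalStart k′ (suc d) (suc i))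
  intervalStart-ghost d i with i <ᵇ d
  ... | true  = cong ℕ.suc (R-shift i)
  ... | false = R-shift d

  InFset-ghost-suc : ∀ {n d i e} → InFset k (suc n) (suc d) (suc i) (suc (suc e)) ⇔ InFset k′ n (suc d) (suc i) (suc e)
  InFset-ghost-suc {n} {d} {i} {e} = mk⇔ to′ from′
    where
    to′ : InFset k (suc n) (suc d) (suc i) (suc (suc e)) → InFset k′ n (suc d) (suc i) (suc e)
    to′ (inj₁ (suc j , 1≤j , j<i , e≡R)) = inj₁ (suc j , 1≤j , j<i , suc-injective (trans e≡R (R-shift j)))
    to′ (inj₂ (start≤e , e≤n)) =
      inj₂ (≤-pred (subst (_≤ suc (suc e)) (intervalStart-ghost d i) start≤e) , ≤-pred e≤n)
    from′ : InFset k′ n (suc d) (suc i) (suc e) → InFset k (suc n) (suc d) (suc i) (suc (suc e))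
    from′ (inj₁ (suc j , 1≤j , j<i , e≡R)) = inj₁ (suc j , 1≤j , j<i , trans (cong ℕ.suc e≡R) (sym (R-shift j)))
    from′ (inj₂ (start≤e , e≤n)) =
      inj₂ (subst (_≤ suc (suc e)) (sym (intervalStart-ghost d i)) (s≤s start≤e) , s≤s e≤n)

  InFset-ghost-one : ∀ {n d i} → ¬ InFset k (suc n) (suc d) (suc i) 1
  InFset-ghost-one (inj₁ (suc j , _ , _ , 1≡R)) with trans 1≡R (R-shift j)
  ... | ()
  InFset-ghost-one {d = d} {i} (inj₂ (start≤1 , _)) =
    <⇒≱ (s≤s (1≤intervalStart k′ d (suc i))) (subst (_≤ 1) (intervalStart-ghost d i) start≤1)

  IsFset-ghost-inside : ∀ {n d i} {F : Subset n} → ¬ IsFset k (suc n) (suc d) (suc i) (inside ∷ F)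
  IsFset-ghost-inside {n} {d} {i} Fset = InFset-ghost-one {n} {d} {i} (to (Fset zero) here)

  IsFset-ghost-outside : ∀ {n d i} {F : Subset n} →
    IsFset k (suc n) (suc d) (suc i) (outside ∷ F) ⇔ IsFset k′ n (suc d) (suc i) F
  IsFset-ghost-outside {n} {d} {i} = mk⇔
    (λ Fset p → InFset-ghost-suc {n} {d} {i} ⇔-∘ proj₂ (to (IsFset-∷ {k} {n} {suc d} {suc i}) Fset) p)
    (λ Fset → from (IsFset-∷ {k} {n} {suc d} {suc i})
      (mk⇔ (λ ()) (⊥-elim ∘ InFset-ghost-one {n} {d} {i}) , λ p → ⇔-sym (InFset-ghost-suc {n} {d} {i}) ⇔-∘ Fset p))

-- {x₁} ∈ Γ: k′ i = k (i + 1).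
module Cone (k k′ : ℕ → ℕ) (R-shift : ∀ j → R k (suc j) ≡ suc (R k′ j)) where

  intervalStart-cone : ∀ d i → intervalStart k (suc d) (suc i) ≡ suc (intervalStart k′ d i)
  intervalStart-cone d i with i <ᵇ d
  ... | true  = cong ℕ.suc (R-shift i)
  ... | false = R-shift d

  InFset-cone-suc : ∀ {n d i e} → InFset k (suc n) (suc d) (suc i) (suc (suc e)) ⇔ InFset k′ n d i (suc e)
  InFset-cone-suc {n} {d} {i} {e} = mk⇔ to′ from′
    where
    to′ : InFset k (suc n) (suc d) (suc i) (suc (suc e)) → InFset k′ n d i (suc e)
    to′ (inj₁ (suc zero , _ , _ , e≡R)) with trans e≡R (R-shift 0)
    ... | ()
    to′ (inj₁ (suc (suc j) , _ , s≤s j<i , e≡R)) =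
      inj₁ (suc j , s≤s z≤n , j<i , suc-injective (trans e≡R (R-shift (suc j))))
    to′ (inj₂ (start≤e , e≤n)) =
      inj₂ (≤-pred (subst (_≤ suc (suc e)) (intervalStart-cone d i) start≤e) , ≤-pred e≤n)
    from′ : InFset k′ n d i (suc e) → InFset k (suc n) (suc d) (suc i) (suc (suc e))
    from′ (inj₁ (j , _ , j<i , e≡R)) = inj₁ (suc j , s≤s z≤n , s≤s j<i , trans (cong ℕ.suc e≡R) (sym (R-shift j)))
    from′ (inj₂ (start≤e , e≤n)) =
      inj₂ (subst (_≤ suc (suc e)) (sym (intervalStart-cone d i)) (s≤s start≤e) , s≤s e≤n)

  InFset-cone-one : ∀ {n d i} → InFset k (suc n) (suc (suc d)) (suc i) 1 ⇔ 1 ≤ i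
  InFset-cone-one {n} {d} {i} = mk⇔ to′ λ 1≤i → inj₁ (1 , ≤-refl , s≤s 1≤i , sym (R-shift 0))
    where
    to′ : InFset k (suc n) (suc (suc d)) (suc i) 1 → 1 ≤ i
    to′ (inj₁ (_ , 1≤j , s≤s j≤i , _)) = ≤-trans 1≤j j≤i
    to′ (inj₂ (start≤1 , _)) =
      contradiction (subst (_≤ 1) (intervalStart-cone (suc d) i) start≤1) (<⇒≱ (s≤s (1≤intervalStart k′ d i)))

  IsFset-cone-tail : ∀ {n d i x} {F : Subset n} →
    IsFset k (suc n) (suc (suc d)) (suc i) (x ∷ F) → IsFset k′ n (suc d) i F
  IsFset-cone-tail {n} {d} {i} Fset p =
    InFset-cone-suc {n} {suc d} {i} ⇔-∘ proj₂ (to (IsFset-∷ {k} {n} {suc (suc d)} {suc i}) Fset) p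

  IsFset-cone-head : ∀ {n d i x} {F : Subset n} →
    IsFset k (suc n) (suc (suc d)) (suc i) (x ∷ F) → x ≡ inside ⇔ 1 ≤ i
  IsFset-cone-head {n} {d} {i} Fset =
    InFset-cone-one {n} {d} {i} ⇔-∘ proj₁ (to (IsFset-∷ {k} {n} {suc (suc d)} {suc i}) Fset)

  IsFset-cone-∷ : ∀ {n d i x} {F : Subset n} → (x ≡ inside ⇔ 1 ≤ i) → IsFset k′ n (suc d) i F →
    IsFset k (suc n) (suc (suc d)) (suc i) (x ∷ F)
  IsFset-cone-∷ {n} {d} {i} head Fset = from (IsFset-∷ {k} {n} {suc (suc d)} {suc i})
    (⇔-sym (InFset-cone-one {n} {d} {i}) ⇔-∘ head , λ p → ⇔-sym (InFset-cone-suc {n} {suc d} {i}) ⇔-∘ Fset p)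

  IsFset-cone-outside : ∀ {n d i} {F : Subset n} →
    IsFset k (suc n) (suc (suc d)) (suc i) (outside ∷ F) ⇔ (i ≡ 0 × F ≡ ⊤)
  IsFset-cone-outside {n} {d} {zero} = mk⇔
    (λ Fset → refl , to (IsFset-zero⇔⊤ {k′} {n} {d}) (IsFset-cone-tail {n} {d} Fset))
    (λ (_ , F≡⊤) → IsFset-cone-∷ {n} {d} (mk⇔ (λ ()) (λ ())) (from (IsFset-zero⇔⊤ {k′} {n} {d}) F≡⊤))
  IsFset-cone-outside {n} {d} {suc i} = mk⇔ (λ Fset → case from (IsFset-cone-head {n} {d} Fset) (s≤s z≤n) of λ ()) λ ()

  IsFset-cone-inside : ∀ {n d i} {F : Subset n} →
    IsFset k (suc n) (suc (suc d)) (suc i) (inside ∷ F) ⇔ (1 ≤ i × IsFset k′ n (suc d) i F)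
  IsFset-cone-inside {n} {d} = mk⇔ (λ Fset → to (IsFset-cone-head {n} {d} Fset) refl , IsFset-cone-tail {n} {d} Fset)
                                   (λ (1≤i , Fset) → IsFset-cone-∷ {n} {d} (mk⇔ (λ _ → 1≤i) (λ _ → refl)) Fset)

-- Facets of a USLI complex

FacetDescription : ∀ {n} → (ℕ → ℕ) → Family n → ℕ → Set
FacetDescription {n} k Γ d =
  (∀ (F : Subset n) → (IsFacet Γ F ⇔ Σ ℕ (λ i → 1 ≤ i × i ≤ d × IsFset k n d i F)))
  × (∀ (i : ℕ) → 1 ≤ i → i ≤ d → Σ (Subset n) (λ F → IsFset k n d i F))
  × (∀ (i i′ : ℕ) (F : Subset n) → 1 ≤ i → i ≤ d → 1 ≤ i′ → i′ ≤ d →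
       IsFset k n d i F → IsFset k n d i′ F → i ≡ i′)

facet-full⇔⊤ : ∀ {n} {Γ : Family n} → Full Γ → ∀ {F} → IsFacet Γ F ⇔ F ≡ ⊤
facet-full⇔⊤ full = mk⇔ (λ (_ , max) → sym (max ⊤ ⊆⊤ (full ⊤)))
                        (λ { refl → full ⊤ , λ G ⊤⊆G _ → ⊆-antisym ⊆⊤ ⊤⊆G })

facetDescription-simplex : ∀ {n} {Γ : Family n} {k} → Full Γ → k 1 ≡ 0 → FacetDescription k Γ 1
facetDescription-simplex {k = k} full k₁≡0 =
  (λ F → mk⇔ (λ facet → 1 , ≤-refl , ≤-refl , from (IsFset-simplex⇔⊤ {k} k₁≡0) (to (facet-full⇔⊤ full) facet))
             λ { (_ , s≤s z≤n , s≤s z≤n , Fset) →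
                   from (facet-full⇔⊤ full) (to (IsFset-simplex⇔⊤ {k} k₁≡0) Fset) })
  , (λ { _ (s≤s z≤n) (s≤s z≤n) → ⊤ , from (IsFset-simplex⇔⊤ {k} k₁≡0) refl })
  , λ { _ _ _ (s≤s z≤n) (s≤s z≤n) (s≤s z≤n) (s≤s z≤n) _ _ → refl }

facetDescription-void : ∀ {n} {Γ : Family n} {k} → IsSimplicialComplex Γ → Γ ⊥ ≡ false →
  (∀ i → k i ≡ numMinGens Γ i) → ∀ {d} → k d ≢ 0 → FacetDescription k Γ d
facetDescription-void {Γ = Γ} _ ⊥∉Γ k≡ {suc j} k_d≢0 =
  contradiction (trans (k≡ (suc j)) (numMinGens-void Γ ⊥∉Γ j)) k_d≢0
facetDescription-void simp ⊥∉Γ _ {zero} _ =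
  (λ F → mk⇔ (λ (F∈Γ , _) → ⊥-elim (not-¬ (simp _ ⊥ ⊥⊆ F∈Γ) ⊥∉Γ)) λ { (suc _ , _ , () , _) })
  , (λ { (suc _) _ () })
  , λ { (suc _) _ _ _ () }

facetDescription-ghost : ∀ {n} {Γ : Family (suc n)} {k k′ d} → (∀ j → R k (suc j) ≡ suc (R k′ (suc j))) →
  Void (link Γ) → FacetDescription k′ (deletion Γ) (suc d) → FacetDescription k Γ (suc d)
facetDescription-ghost {n} {Γ} {k} {k′} {d} R-shift void (facets , exists , unique) = facets′ , exists′ , unique′
  where
  open Ghost k k′ R-shift

  facets′ : ∀ F → IsFacet Γ F ⇔ Σ ℕ (λ i → 1 ≤ i × i ≤ suc d × IsFset k (suc n) (suc d) i F)
  facets′ (inside ∷ F) = mk⇔ (λ (F∈Γ , _) → ⊥-elim (not-¬ F∈Γ (void F)))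
                             λ { (suc i , _ , _ , Fset) → ⊥-elim (IsFset-ghost-inside {n} {d} {i} Fset) }
  facets′ (outside ∷ F) = mk⇔
    (λ facet → case to (facets F) (facet-outside⇒ facet) of
      λ { (suc i , 1≤i , i≤d , Fset) → suc i , 1≤i , i≤d , from (IsFset-ghost-outside {n} {d} {i}) Fset })
    λ { (suc i , 1≤i , i≤d , Fset) →
          facet-outside-void⇐ void (from (facets F) (suc i , 1≤i , i≤d , to (IsFset-ghost-outside {n} {d} {i}) Fset)) }

  exists′ : ∀ i → 1 ≤ i → i ≤ suc d → Σ (Subset (suc n)) (IsFset k (suc n) (suc d) i)
  exists′ (suc i) 1≤i i≤d = let F , Fset = exists (suc i) 1≤i i≤d in
    outside ∷ F , from (IsFset-ghost-outside {n} {d} {i}) Fset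

  unique′ : ∀ i i′ F → 1 ≤ i → i ≤ suc d → 1 ≤ i′ → i′ ≤ suc d →
    IsFset k (suc n) (suc d) i F → IsFset k (suc n) (suc d) i′ F → i ≡ i′
  unique′ (suc i) (suc i′) (inside ∷ F) _ _ _ _ Fset _ = ⊥-elim (IsFset-ghost-inside {n} {d} {i} Fset)
  unique′ (suc i) (suc i′) (outside ∷ F) 1≤i i≤d 1≤i′ i′≤d Fset Fset′ =
    unique (suc i) (suc i′) F 1≤i i≤d 1≤i′ i′≤d
    (to (IsFset-ghost-outside {n} {d} {i}) Fset) (to (IsFset-ghost-outside {n} {d} {i′}) Fset′)

facetDescription-cone : ∀ {n} {Γ : Family (suc n)} {k k′ d} → (∀ j → R k (suc j) ≡ suc (R k′ j)) →
  Full (deletion Γ) → link Γ ⊤ ≡ false → FacetDescription k′ (link Γ) (suc d) → FacetDescription k Γ (suc (suc d))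
facetDescription-cone {n} {Γ} {k} {k′} {d} R-shift full ⊤∉link (facets , exists , unique) = facets′ , exists′ , unique′
  where
  open Cone k k′ R-shift

  facets′ : ∀ F → IsFacet Γ F ⇔ Σ ℕ (λ i → 1 ≤ i × i ≤ suc (suc d) × IsFset k (suc n) (suc (suc d)) i F)
  facets′ (outside ∷ F) = mk⇔
    (λ facet → 1 , ≤-refl , s≤s z≤n , from (IsFset-cone-outside {n} {d} {0}) (refl , facet-outside-full⇒ full facet))
    λ { (suc i , _ , _ , Fset) → case to (IsFset-cone-outside {n} {d} {i}) Fset of
          λ { (refl , refl) → facet-outside-full⇐ full ⊤∉link } }
  facets′ (inside ∷ F) = mk⇔
    (λ facet → case to (facets F) (to facet-inside facet) of
      λ { (i , 1≤i , i≤d , Fset) → suc i , s≤s z≤n , s≤s i≤d , from (IsFset-cone-inside {n} {d} {i}) (1≤i , Fset) })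
    λ { (suc i , _ , s≤s i≤d , Fset) → case to (IsFset-cone-inside {n} {d} {i}) Fset of
          λ { (1≤i , Fset′) → from facet-inside (from (facets F) (i , 1≤i , i≤d , Fset′)) } }

  exists′ : ∀ i → 1 ≤ i → i ≤ suc (suc d) → Σ (Subset (suc n)) (IsFset k (suc n) (suc (suc d)) i)
  exists′ (suc zero) _ _ = outside ∷ ⊤ , from (IsFset-cone-outside {n} {d} {0}) (refl , refl)
  exists′ (suc (suc i)) _ (s≤s i≤d) = let F , Fset = exists (suc i) (s≤s z≤n) i≤d in
    inside ∷ F , from (IsFset-cone-inside {n} {d} {suc i}) (s≤s z≤n , Fset)

  unique′ : ∀ i i′ F → 1 ≤ i → i ≤ suc (suc d) → 1 ≤ i′ → i′ ≤ suc (suc d) →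
    IsFset k (suc n) (suc (suc d)) i F → IsFset k (suc n) (suc (suc d)) i′ F → i ≡ i′
  unique′ (suc i) (suc i′) (outside ∷ F) _ _ _ _ Fset Fset′
    with to (IsFset-cone-outside {n} {d} {i}) Fset | to (IsFset-cone-outside {n} {d} {i′}) Fset′
  ... | refl , _ | refl , _ = refl
  unique′ (suc i) (suc i′) (inside ∷ F) _ (s≤s i≤d) _ (s≤s i′≤d) Fset Fset′
    with to (IsFset-cone-inside {n} {d} {i}) Fset | to (IsFset-cone-inside {n} {d} {i′}) Fset′
  ... | 1≤i , Fsetᵢ | 1≤i′ , Fsetᵢ′ = cong ℕ.suc (unique i i′ F 1≤i i≤d 1≤i′ i′≤d Fsetᵢ Fsetᵢ′)

numMinGens-full : ∀ {n} {Γ : Family n} → Full Γ → ∀ i → numMinGens Γ i ≡ 0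
numMinGens-full {Γ = Γ} full i = count-none (isMinGen? Γ i) λ F ((F∉Γ , _) , _) → not-¬ (full F) F∉Γ

nonface⇒⊤∉ : ∀ {n} {Γ : Family n} → IsSimplicialComplex Γ → IΓ≢0 Γ → Γ ⊤ ≡ false
nonface⇒⊤∉ {Γ = Γ} simp (F , F∉Γ) with Γ ⊤ in ⊤∈Γ
... | false = refl
... | true  = ⊥-elim (not-¬ (simp ⊤ F ⊆⊤ ⊤∈Γ) F∉Γ)

facetDescription : ∀ {n} {Γ : Family n} {k} → IsSimplicialComplex Γ → IsUSLI Γ → (∀ i → k i ≡ numMinGens Γ i) →
  Γ ⊥ ≡ true → ∀ {d} → k d ≢ 0 → (∀ i → d < i → k i ≡ 0) → FacetDescription k Γ d
facetDescription {zero} {Γ} _ _ k≡ ⊥∈Γ {d} k_d≢0 _ =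
  contradiction (trans (k≡ d) (numMinGens-full {Γ = Γ} (λ { [] → ⊥∈Γ }) d)) k_d≢0
facetDescription {suc n} {Γ} {k} simp usli k≡ ⊥∈Γ {d} k_d≢0 top with Γ ⁅ zero ⁆ in ⁅0⁆∈Γ
... | false = ghost d k_d≢0 top
  where
  void = link-void simp ⁅0⁆∈Γ
  k′ = numMinGens (deletion Γ)
  k₂₊ : ∀ j → k (suc (suc j)) ≡ k′ (suc (suc j))
  k₂₊ j = trans (k≡ _) (numMinGens-void-link-suc-suc simp ⊥∈Γ void j)
  R-shift = R-shift-ghost (trans (k≡ 1) (numMinGens-void-link-one simp ⊥∈Γ void)) k₂₊
  ghost : ∀ d → k d ≢ 0 → (∀ i → d < i → k i ≡ 0) → FacetDescription k Γ d
  ghost zero k₀≢0 _ = contradiction (trans (k≡ 0) (numMinGens-zero Γ ⊥∈Γ)) k₀≢0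
  ghost (suc d) k_d≢0 top with k′ (suc d) ≟ℕ 0
  ... | no k′_d≢0 = facetDescription-ghost R-shift void
    (facetDescription (deletion-simplicial simp) (deletion-USLI usli) (λ _ → refl) ⊥∈Γ k′_d≢0 top′)
    where
    top′ : ∀ i → suc d < i → k′ i ≡ 0
    top′ (suc zero) (s≤s ())
    top′ (suc (suc j)) d<i = trans (sym (k₂₊ j)) (top _ d<i)
  -- The deletion has no generator of degree d only if d = 1 and it is a full simplex.
  ghost (suc (suc d)) k_d≢0 _ | yes k′_d≡0 = contradiction (trans (k₂₊ d) k′_d≡0) k_d≢0
  ghost (suc zero) _ top | yes k′₁≡0 = facetDescription-ghost R-shift void (facetDescription-simplex full k′₁≡0)
    where
    full : Full (deletion Γ)
    full = numMinGens≡0⇒full (deletion Γ) λ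
      { zero → numMinGens-zero (deletion Γ) ⊥∈Γ
      ; (suc zero) → k′₁≡0
      ; (suc (suc j)) → trans (sym (k₂₊ j)) (top _ (s≤s (s≤s z≤n))) }
... | true = cone d k_d≢0 top
  where
  full = deletion-full usli simp ⁅0⁆∈Γ
  k≡′ : ∀ i → k (suc i) ≡ numMinGens (link Γ) i
  k≡′ i = trans (k≡ (suc i)) (numMinGens-full-deletion full i)
  k₁≡0 : k 1 ≡ 0
  k₁≡0 = trans (k≡′ 0) (numMinGens-zero (link Γ) ⁅0⁆∈Γ)
  cone : ∀ d → k d ≢ 0 → (∀ i → d < i → k i ≡ 0) → FacetDescription k Γ d
  cone zero k₀≢0 _ = contradiction (trans (k≡ 0) (numMinGens-zero Γ ⊥∈Γ)) k₀≢0
  cone (suc zero) k₁≢0 _ = contradiction k₁≡0 k₁≢0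
  cone (suc (suc d)) k_d≢0 top = facetDescription-cone (R-shift-cone k₁≡0) full
    (nonface⇒⊤∉ (link-simplicial simp) (numMinGens-witness (link Γ) (k_d≢0 ∘ trans (k≡′ (suc d)))))
    (facetDescription (link-simplicial simp) (link-USLI usli full) k≡′ ⁅0⁆∈Γ k_d≢0 λ i d<i → top (suc i) (s≤s d<i))

lemma4p3 : (n : ℕ) (Γ : Family n) (k : ℕ → ℕ) →
    IsSimplicialComplex Γ → IsUSLI Γ → (∀ (i : ℕ) → k i ≡ numMinGens Γ i) →
    ((IΓ≢0 Γ → (d : ℕ) → k d ≢ 0 → (∀ (i : ℕ) → d < i → k i ≡ 0) →
        ((∀ (F : Subset n) → (IsFacet Γ F ⇔ Σ ℕ (λ i → 1 ≤ i × i ≤ d × IsFset k n d i F)))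
        × (∀ (i : ℕ) → 1 ≤ i → i ≤ d → Σ (Subset n) (λ F → IsFset k n d i F))
        × (∀ (i i′ : ℕ) (F : Subset n) → 1 ≤ i → i ≤ d → 1 ≤ i′ → i′ ≤ d →
             IsFset k n d i F → IsFset k n d i′ F → i ≡ i′)))
    × (∀ (Γ′ : Family n) → IsSimplicialComplex Γ′ → IsShifted Γ′ →
        (∀ (i : ℕ) → fvec Γ′ i ≡ fvec Γ i) → ∀ (F : Subset n) → Γ′ F ≡ Γ F))
lemma4p3 n Γ k simp usli k≡ = facets , λ Γ′ simp′ shifted f → shifted-unique simp usli simp′ shifted f
  where
  facets : IΓ≢0 Γ → ∀ d → k d ≢ 0 → (∀ i → d < i → k i ≡ 0) → FacetDescription k Γ d
  -- I_Γ ≠ 0 already follows from k d ≢ 0.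
  facets _ d k_d≢0 top with Γ ⊥ in ⊥∈Γ
  ... | true  = facetDescription simp usli k≡ ⊥∈Γ k_d≢0 top
  ... | false = facetDescription-void simp ⊥∈Γ k≡ k_d≢0
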